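{- Let $k\ge 1$. For all integers $n>1$ and $1\le j\le k$, $$U^k_j(n) = U^k_j(n-1) + U^k_{j-1}(n-1) + \sum_{t=2}^{n-1} \binom{n-1}{t-1}\, U^k_{k-1}(t-1)\, U^k_j(n-t).$$
   Context: For a permutation $p=(p_1,\dots,p_n)$ of $\{1,\dots,n\}$, an increasing run is a maximal increasing subsequence of consecutive entries $p_a<p_{a+1}<\dots<p_b$; its length is its number of entries $b-a+1$. The final increasing run is the increasing run containing $p_n$. For integers $k\ge1$, $1\le j\le k$ and $n\ge 1$, let $U^k_j(n)$ be the number of permutations of $\{1,\dots,n\}$ all of whose increasing runs have length at most $k$ and whose final increasing run has length at most $j$. In particular $U^k_j(1)=1$ for all $1\le j\le k$. By convention $U^k_j(n)=0$ whenever $j<1$. -}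

module Defs where

open import Data.Nat using (ℕ; zero; suc; _+_; _*_; _∸_; _<ᵇ_; _≤ᵇ_; _≡ᵇ_)
open import Data.Bool using (Bool; true; false; _∧_; not; if_then_else_)
open import Data.List using (List; []; _∷_; map; concatMap; length; filterᵇ; upTo)
open import Data.Nat.ListAction using (sum)
open import Data.Bool.ListAction using (all; any)
open import Data.Maybe using (Maybe; just; nothing)

words : ℕ → ℕ → List (List ℕ)
words zero    n = [] ∷ []
words (suc m) n = concatMap (λ w → map (λ i → suc i ∷ w) (upTo n)) (words m n)

distinct : List ℕ → Bool
distinct []       = true
distinct (x ∷ xs) = not (any (λ y → x ≡ᵇ y) xs) ∧ distinct xs

-- Permutations of {1,…,n} in one-line notation (p₁,…,pₙ):
-- words of length n over {1,…,n} with pairwise distinct entries.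
perms : ℕ → List (List ℕ)
perms n = filterᵇ distinct (words n n)

-- Lengths of the maximal increasing runs of a list, from left to right.
runsFrom : ℕ → ℕ → List ℕ → List ℕ
runsFrom prev len []       = len ∷ []
runsFrom prev len (y ∷ ys) =
  if prev <ᵇ y then runsFrom y (suc len) ys else len ∷ runsFrom y 1 ys

runLengths : List ℕ → List ℕ
runLengths []       = []
runLengths (x ∷ xs) = runsFrom x 1 xs

lastRun : List ℕ → Maybe ℕ
lastRun xs = Data.List.last (runLengths xs)

admissible : ℕ → ℕ → List ℕ → Bool
admissible k j p with lastRun p
... | nothing = false
... | just l  = all (λ r → r ≤ᵇ k) (runLengths p) ∧ (l ≤ᵇ j)

-- U^k_j(n), counted by enumeration.  With j = 0 (j < 1) this is 0 for n ≥ 1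
-- automatically; we also impose the convention explicitly.
U : ℕ → ℕ → ℕ → ℕ
U k zero    n = 0
U k (suc j) n = length (filterᵇ (admissible k (suc j)) (perms n))

-- ∑_{t=a}^{b} f t  (empty if b < a)
sumFromTo : ℕ → ℕ → (ℕ → ℕ) → ℕ
sumFromTo a b f = sum (map (λ i → f (a + i)) (upTo (suc b ∸ a)))

module Submission where

-- The recurrence
--   U^k_j(n) = U^k_j(n-1) + U^k_{j-1}(n-1) + ∑_{t=2}^{n-1} C(n-1,t-1) U^k_{k-1}(t-1) U^k_j(n-t)
-- comes from inserting the largest value into a permutation of {1,…,n-1}.
--
-- `Perm n` enumerates the permutations of {1,…,n} by inserting n into every permutation of
-- {1,…,n-1} at every position.  Inserting a new maximum X into w in front of w adds a run of
-- length 1; at the end it lengthens the final run by one; and right after the first t-1 entries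
-- (1 < t < n) it lengthens the final run of the prefix by one, the suffix keeping its runs.  So
-- the three kinds of positions contribute U^k_j(n-1), U^k_{j-1}(n-1) and, for each t, a sum over
-- w of [prefix admissible for (k, k-1)] · [suffix admissible for (k, j)].  The last sum is
-- evaluated by the shuffle lemma: for statistics A, B depending only on the relative order of
-- the entries, ∑_{q ∈ Perm(a+b)} A(q₁…qₐ) B(qₐ₊₁…) = C(a+b,a) · ∑_{Perm a} A · ∑_{Perm b} B.

open import Defs
open import Data.Nat using (ℕ; _+_; _*_; _∸_; _≤_; _<_)
open import Data.Nat.Combinatorics using (_C_)
open import Relation.Binary.PropositionalEquality using (_≡_)

open import Data.Nat.Base using (zero; suc; _<ᵇ_; _≤ᵇ_; _≡ᵇ_; _⊔_; _⊓_; z≤n; s≤s; s≤s⁻¹; z<s)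
open import Data.Nat.Properties
open import Data.Nat.Combinatorics using (nCn≡1; nCk+nC[k+1]≡[n+1]C[k+1])
open import Algebra.Properties.CommutativeSemigroup +-commutativeSemigroup using (interchange; x∙yz≈y∙xz; xy∙z≈xz∙y)
open import Data.Bool using (Bool; true; false; _∧_; if_then_else_; T)
open import Data.Bool.Properties using (T?; T-∧; ∧-assoc; ∧-identityʳ; ∧-zeroʳ)
open import Data.Bool.ListAction using (all; any)
open import Data.List using (List; []; _∷_; map; concatMap; length; filterᵇ; upTo; applyUpTo; _++_; take; drop; cartesianProductWith; cartesianProduct; last; [_])
open import Data.List.Properties using (applyUpTo-∷ʳ; take-all; drop-all; length-take; length-drop; length-map; length-++; ++-assoc; ++-identityʳ; ∷-injective)
open import Data.Nat.ListAction using (sum)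
open import Data.Maybe using (just)
open import Data.Product using (∃₂; _×_; _,_; proj₁; proj₂)
open import Data.Empty using (⊥-elim)
open import Data.Unit using (tt)
open import Relation.Nullary using (¬_; yes; no)
open import Relation.Binary.PropositionalEquality using (refl; sym; trans; cong; cong₂; subst; _≢_; module ≡-Reasoning)
open import Data.List.Relation.Unary.All as All using (All; []; _∷_)
import Data.List.Relation.Unary.All.Properties as AllP
open import Data.List.Relation.Unary.Any using (here; there)
open import Data.List.Relation.Unary.All.Properties.Core using (¬Any⇒All¬)
open import Data.List.Membership.Propositional using (_∈_)
open import Data.List.Membership.Propositional.Properties using (∈-map⁻; ∈-map⁺; ∈-cartesianProduct⁻; ∈-cartesianProduct⁺; ∈-upTo⁻; ∈-upTo⁺; ∈-filter⁻; ∈-filter⁺; ∈-∃++; ∈-cartesianProductWith⁻; ∈-cartesianProductWith⁺)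
open import Data.List.Membership.DecPropositional _≟_ using (_∈?_)
open import Data.List.Membership.Propositional.Properties.WithK using (unique∧set⇒bag)
open import Data.List.Relation.Unary.Unique.Propositional using (Unique)
open import Data.List.Relation.Unary.AllPairs using ([]; _∷_)
import Data.List.Relation.Unary.Unique.Propositional.Properties as UniqueP
open import Data.List.Relation.Binary.BagAndSetEquality using (∼bag⇒↭)
open import Data.List.Relation.Binary.Permutation.Propositional using (_↭_)
open import Data.List.Relation.Binary.Permutation.Propositional.Properties using (↭-length; filter-↭)
open import Function using (_∘_; Equivalence)
open import Function.Bundles using (mk⇔)

-- Finite sums over lists.

∑ : {A : Set} → List A → (A → ℕ) → ℕ
∑ []       f = 0
∑ (x ∷ xs) f = f x + ∑ xs f

∑-++ : {A : Set} (xs ys : List A) (f : A → ℕ) → ∑ (xs ++ ys) f ≡ ∑ xs f + ∑ ys f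
∑-++ []       ys f = refl
∑-++ (x ∷ xs) ys f = trans (cong (f x +_) (∑-++ xs ys f)) (sym (+-assoc (f x) _ _))

∑-cong : {A : Set} (xs : List A) {f g : A → ℕ} → (∀ {x} → x ∈ xs → f x ≡ g x) → ∑ xs f ≡ ∑ xs g
∑-cong []       e = refl
∑-cong (x ∷ xs) e = cong₂ _+_ (e (here refl)) (∑-cong xs (e ∘ there))

∑-+ : {A : Set} (xs : List A) (f g : A → ℕ) → ∑ xs (λ x → f x + g x) ≡ ∑ xs f + ∑ xs g
∑-+ []       f g = refl
∑-+ (x ∷ xs) f g = trans (cong (f x + g x +_) (∑-+ xs f g)) (interchange (f x) (g x) (∑ xs f) (∑ xs g))

∑-*ˡ : {A : Set} (xs : List A) (c : ℕ) (f : A → ℕ) → ∑ xs (λ x → c * f x) ≡ c * ∑ xs f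
∑-*ˡ []       c f = sym (*-zeroʳ c)
∑-*ˡ (x ∷ xs) c f = trans (cong (c * f x +_) (∑-*ˡ xs c f)) (sym (*-distribˡ-+ c (f x) (∑ xs f)))

∑-*ʳ : {A : Set} (xs : List A) (c : ℕ) (f : A → ℕ) → ∑ xs (λ x → f x * c) ≡ ∑ xs f * c
∑-*ʳ xs c f = trans (∑-cong xs (λ {x} _ → *-comm (f x) c)) (trans (∑-*ˡ xs c f) (*-comm c _))

∑-zero : {A : Set} (xs : List A) → ∑ xs (λ _ → 0) ≡ 0
∑-zero []       = refl
∑-zero (x ∷ xs) = ∑-zero xs

∑-swap : {A B : Set} (xs : List A) (ys : List B) (f : A → B → ℕ) →
  ∑ xs (λ x → ∑ ys (f x)) ≡ ∑ ys (λ y → ∑ xs (λ x → f x y))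
∑-swap []       ys f = sym (∑-zero ys)
∑-swap (x ∷ xs) ys f = trans (cong (∑ ys (f x) +_) (∑-swap xs ys f))
                             (sym (∑-+ ys (f x) (λ y → ∑ xs (λ x' → f x' y))))

∑-map : {A B : Set} (xs : List A) (g : A → B) (f : B → ℕ) → ∑ (map g xs) f ≡ ∑ xs (f ∘ g)
∑-map []       g f = refl
∑-map (x ∷ xs) g f = cong (f (g x) +_) (∑-map xs g f)

∑-cartesianProduct : {A B : Set} (xs : List A) (ys : List B) (f : A × B → ℕ) →
  ∑ (cartesianProduct xs ys) f ≡ ∑ xs (λ x → ∑ ys (λ y → f (x , y)))
∑-cartesianProduct []       ys f = refl
∑-cartesianProduct (x ∷ xs) ys f = trans (∑-++ (map (x ,_) ys) _ f)
  (cong₂ _+_ (∑-map ys (x ,_) f) (∑-cartesianProduct xs ys f))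

∑-applyUpTo : (h : ℕ → ℕ) (n : ℕ) (f : ℕ → ℕ) → ∑ (applyUpTo h n) f ≡ ∑ (upTo n) (f ∘ h)
∑-applyUpTo h zero    f = refl
∑-applyUpTo h (suc n) f = cong (f (h 0) +_)
  (trans (∑-applyUpTo (h ∘ suc) n f) (sym (∑-applyUpTo suc n (f ∘ h))))

∑-upTo-+ : (m n : ℕ) (f : ℕ → ℕ) → ∑ (upTo (m + n)) f ≡ ∑ (upTo m) f + ∑ (upTo n) (λ r → f (m + r))
∑-upTo-+ zero    n f = refl
∑-upTo-+ (suc m) n f = begin
    f 0 + ∑ (applyUpTo suc (m + n)) f
  ≡⟨ cong (f 0 +_) (∑-applyUpTo suc (m + n) f) ⟩
    f 0 + ∑ (upTo (m + n)) (f ∘ suc)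
  ≡⟨ cong (f 0 +_) (∑-upTo-+ m n (f ∘ suc)) ⟩
    f 0 + (∑ (upTo m) (f ∘ suc) + ∑ (upTo n) (λ r → f (suc m + r)))
  ≡⟨ sym (+-assoc (f 0) _ _) ⟩
    f 0 + ∑ (upTo m) (f ∘ suc) + ∑ (upTo n) (λ r → f (suc m + r))
  ≡⟨ cong (λ z → f 0 + z + ∑ (upTo n) (λ r → f (suc m + r))) (sym (∑-applyUpTo suc m f)) ⟩
    f 0 + ∑ (applyUpTo suc m) f + ∑ (upTo n) (λ r → f (suc m + r))
  ∎
  where open ≡-Reasoning

∑-upTo-ends : (m : ℕ) (f : ℕ → ℕ) → ∑ (upTo (2 + m)) f ≡ f 0 + ∑ (upTo m) (f ∘ suc) + f (suc m)
∑-upTo-ends m f = begin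
    f 0 + ∑ (applyUpTo suc (suc m)) f
  ≡⟨ cong (λ L → f 0 + ∑ L f) (sym (applyUpTo-∷ʳ suc m)) ⟩
    f 0 + ∑ (applyUpTo suc m ++ [ suc m ]) f
  ≡⟨ cong (f 0 +_) (∑-++ (applyUpTo suc m) [ suc m ] f) ⟩
    f 0 + (∑ (applyUpTo suc m) f + (f (suc m) + 0))
  ≡⟨ cong₂ (λ a b → f 0 + (a + b)) (∑-applyUpTo suc m f) (+-identityʳ (f (suc m))) ⟩
    f 0 + (∑ (upTo m) (f ∘ suc) + f (suc m))
  ≡⟨ sym (+-assoc (f 0) _ _) ⟩
    f 0 + ∑ (upTo m) (f ∘ suc) + f (suc m)
  ∎
  where open ≡-Reasoning

sum-map : (f : ℕ → ℕ) (xs : List ℕ) → sum (map f xs) ≡ ∑ xs f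
sum-map f []       = refl
sum-map f (x ∷ xs) = cong (f x +_) (sum-map f xs)

∑-mono : {A : Set} (xs : List A) {f g : A → ℕ} → (∀ x → f x ≤ g x) → ∑ xs f ≤ ∑ xs g
∑-mono []       h = z≤n
∑-mono (x ∷ xs) h = +-mono-≤ (h x) (∑-mono xs h)

𝟙 : Bool → ℕ
𝟙 b = if b then 1 else 0

𝟙-∧ : ∀ b c → 𝟙 (b ∧ c) ≡ 𝟙 b * 𝟙 c
𝟙-∧ false c = refl
𝟙-∧ true  c = sym (*-identityˡ (𝟙 c))

length-filterᵇ : {A : Set} (p : A → Bool) (xs : List A) → length (filterᵇ p xs) ≡ ∑ xs (𝟙 ∘ p)
length-filterᵇ p []       = refl
length-filterᵇ p (x ∷ xs) with p x
... | true  = cong suc (length-filterᵇ p xs)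
... | false = length-filterᵇ p xs

T-ext : {b c : Bool} → (T b → T c) → (T c → T b) → b ≡ c
T-ext {false} {false} _ _ = refl
T-ext {false} {true}  _ g = ⊥-elim (g tt)
T-ext {true}  {false} f _ = ⊥-elim (f tt)
T-ext {true}  {true}  _ _ = refl

<ᵇ-true : ∀ {m n} → m < n → (m <ᵇ n) ≡ true
<ᵇ-true m<n = T-ext (λ _ → tt) (λ _ → <⇒<ᵇ m<n)

<ᵇ-false : ∀ {m n} → ¬ m < n → (m <ᵇ n) ≡ false
<ᵇ-false {m} {n} m≮n = T-ext (λ t → m≮n (<ᵇ⇒< m n t)) (λ ())

≡ᵇ-false : ∀ {m n} → m ≢ n → (m ≡ᵇ n) ≡ false
≡ᵇ-false {m} {n} m≢n = T-ext (λ t → m≢n (≡ᵇ⇒≡ m n t)) (λ ())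

≤ᵇ-suc : ∀ a b → (suc a ≤ᵇ suc b) ≡ (a ≤ᵇ b)
≤ᵇ-suc a b = T-ext (λ t → ≤⇒≤ᵇ (s≤s⁻¹ (≤ᵇ⇒≤ (suc a) (suc b) t)))
                   (λ t → ≤⇒≤ᵇ (s≤s (≤ᵇ⇒≤ a b t)))

≤ᵇ-⊓ : ∀ a m n → ((a ≤ᵇ m) ∧ (a ≤ᵇ n)) ≡ (a ≤ᵇ m ⊓ n)
≤ᵇ-⊓ a m n = T-ext to from
  where
  to : T ((a ≤ᵇ m) ∧ (a ≤ᵇ n)) → T (a ≤ᵇ m ⊓ n)
  to t with Equivalence.to T-∧ t
  ... | a≤m , a≤n = ≤⇒≤ᵇ (⊓-glb (≤ᵇ⇒≤ a m a≤m) (≤ᵇ⇒≤ a n a≤n))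
  from : T (a ≤ᵇ m ⊓ n) → T ((a ≤ᵇ m) ∧ (a ≤ᵇ n))
  from t = Equivalence.from T-∧
    (≤⇒≤ᵇ (≤-trans (≤ᵇ⇒≤ a _ t) (m⊓n≤m m n)) , ≤⇒≤ᵇ (≤-trans (≤ᵇ⇒≤ a _ t) (m⊓n≤n m n)))

all-++ : (f : ℕ → Bool) (xs ys : List ℕ) → all f (xs ++ ys) ≡ (all f xs ∧ all f ys)
all-++ f []       ys = refl
all-++ f (x ∷ xs) ys = trans (cong (f x ∧_) (all-++ f xs ys)) (sym (∧-assoc (f x) _ _))

-- ins s x w puts x right after the first s entries of w (at the end if s ≥ length w).
ins : ℕ → ℕ → List ℕ → List ℕ
ins zero    x w       = x ∷ w
ins (suc s) x []      = x ∷ []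
ins (suc s) x (y ∷ w) = y ∷ ins s x w

length-ins : ∀ s x w → length (ins s x w) ≡ suc (length w)
length-ins zero    x w       = refl
length-ins (suc s) x []      = refl
length-ins (suc s) x (y ∷ w) = cong suc (length-ins s x w)

All-ins : {P : ℕ → Set} → ∀ s {x w} → P x → All P w → All P (ins s x w)
All-ins zero    px pw       = px ∷ pw
All-ins (suc s) px []       = px ∷ []
All-ins (suc s) px (q ∷ pw) = q ∷ All-ins s px pw

map-ins : (f : ℕ → ℕ) → ∀ s x w → map f (ins s x w) ≡ ins s (f x) (map f w)
map-ins f zero    x w       = refl
map-ins f (suc s) x []      = refl
map-ins f (suc s) x (y ∷ w) = cong (f y ∷_) (map-ins f s x w)

∑-ins : (f : ℕ → ℕ) → ∀ s x w → ∑ (ins s x w) f ≡ f x + ∑ w f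
∑-ins f zero    x w       = refl
∑-ins f (suc s) x []      = refl
∑-ins f (suc s) x (y ∷ w) = trans (cong (f y +_) (∑-ins f s x w)) (x∙yz≈y∙xz (f y) (f x) (∑ w f))

ins-take-drop : ∀ s x w → s ≤ length w → ins s x w ≡ take s w ++ x ∷ drop s w
ins-take-drop zero    x w       _        = refl
ins-take-drop (suc s) x (y ∷ w) (s≤s le) = cong (y ∷_) (ins-take-drop s x w le)

ins-length : ∀ u x v → ins (length u) x (u ++ v) ≡ u ++ x ∷ v
ins-length []      x v = refl
ins-length (y ∷ u) x v = cong (y ∷_) (ins-length u x v)

ins-beyond : ∀ s x w → length w ≤ s → ins s x w ≡ w ++ [ x ]
ins-beyond zero    x []      _        = refl
ins-beyond (suc s) x []      _        = refl
ins-beyond (suc s) x (y ∷ w) (s≤s le) = cong (y ∷_) (ins-beyond s x w le)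

take-ins-≤ : ∀ a s x w → s ≤ a → take (suc a) (ins s x w) ≡ ins s x (take a w)
take-ins-≤ a       zero    x w       _        = refl
take-ins-≤ (suc a) (suc s) x []      _        = refl
take-ins-≤ (suc a) (suc s) x (y ∷ w) (s≤s le) = cong (y ∷_) (take-ins-≤ a s x w le)

drop-ins-≤ : ∀ a s x w → s ≤ a → drop (suc a) (ins s x w) ≡ drop a w
drop-ins-≤ a       zero    x w       _        = refl
drop-ins-≤ (suc a) (suc s) x []      _        = refl
drop-ins-≤ (suc a) (suc s) x (y ∷ w) (s≤s le) = drop-ins-≤ a s x w le

take-ins-≥ : ∀ a r x w → a ≤ length w → take a (ins (a + r) x w) ≡ take a w
take-ins-≥ zero    r x w       _        = refl
take-ins-≥ (suc a) r x (y ∷ w) (s≤s le) = cong (y ∷_) (take-ins-≥ a r x w le)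

drop-ins-≥ : ∀ a r x w → a ≤ length w → drop a (ins (a + r) x w) ≡ ins r x (drop a w)
drop-ins-≥ zero    r x w       _        = refl
drop-ins-≥ (suc a) r x (y ∷ w) (s≤s le) = drop-ins-≥ a r x w le

ins-injective : ∀ s s' X w w' → All (_< X) w → All (_< X) w' → s ≤ length w → s' ≤ length w' →
  ins s X w ≡ ins s' X w' → s ≡ s' × w ≡ w'
ins-injective zero zero X w w' _ _ _ _ e = refl , proj₂ (∷-injective e)
ins-injective zero (suc s') X w (y' ∷ w') _ (y'<X ∷ _) _ _ e =
  ⊥-elim (<-irrefl (sym (proj₁ (∷-injective e))) y'<X)
ins-injective (suc s) zero X (y ∷ w) w' (y<X ∷ _) _ _ _ e = ⊥-elim (<-irrefl (proj₁ (∷-injective e)) y<X)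
ins-injective (suc s) (suc s') X (y ∷ w) (y' ∷ w') (_ ∷ bw) (_ ∷ bw') (s≤s le) (s≤s le') e
  with ∷-injective e
... | refl , e' with ins-injective s s' X w w' bw bw' le le' e'
...   | refl , refl = refl , refl

Unique-ins : ∀ s {X w} → All (X ≢_) w → Unique w → Unique (ins s X w)
Unique-ins zero    X∉w        u        = X∉w ∷ u
Unique-ins (suc s) []         []       = [] ∷ []
Unique-ins (suc s) (X≢y ∷ X∉w) (y∉w ∷ u) = All-ins s (X≢y ∘ sym) y∉w ∷ Unique-ins s X∉w u

-- The enumeration of permutations by insertion.

insertAt : ℕ → List ℕ × ℕ → List ℕ
insertAt X (w , s) = ins s X w

Perm : ℕ → List (List ℕ)
Perm zero    = [] ∷ []
Perm (suc n) = map (insertAt (suc n)) (cartesianProduct (Perm n) (upTo (suc n)))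

∑-Perm-suc : (n : ℕ) (f : List ℕ → ℕ) →
  ∑ (Perm (suc n)) f ≡ ∑ (Perm n) (λ w → ∑ (upTo (suc n)) (λ s → f (ins s (suc n) w)))
∑-Perm-suc n f = trans (∑-map (cartesianProduct (Perm n) (upTo (suc n))) (insertAt (suc n)) f)
                       (∑-cartesianProduct (Perm n) (upTo (suc n)) (f ∘ insertAt (suc n)))

InRange : ℕ → ℕ → Set
InRange n x = 1 ≤ x × x ≤ n

IsPerm : ℕ → List ℕ → Set
IsPerm n p = length p ≡ n × All (InRange n) p × Unique p

IsPerm-bounded : ∀ {n p} → IsPerm n p → All (_< suc n) p
IsPerm-bounded (_ , inRange , _) = All.map (s≤s ∘ proj₂) inRange

Perm-isPerm : ∀ n {p} → p ∈ Perm n → IsPerm n p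
Perm-isPerm zero    (here refl) = refl , [] , []
Perm-isPerm (suc n) mem with ∈-map⁻ (insertAt (suc n)) mem
... | (w , s) , mem′ , refl with Perm-isPerm n (proj₁ (∈-cartesianProduct⁻ (Perm n) (upTo (suc n)) mem′))
... | len , inRange , u =
  trans (length-ins s (suc n) w) (cong suc len) ,
  All-ins s (z<s , ≤-refl) (All.map (λ (pos , x≤n) → pos , m≤n⇒m≤1+n x≤n) inRange) ,
  Unique-ins s (All.map (λ (_ , x≤n) e → <-irrefl (sym e) (s≤s x≤n)) inRange) u

Perm-length : ∀ n {p} → p ∈ Perm n → length p ≡ n
Perm-length n = proj₁ ∘ Perm-isPerm n

Perm-bounded : ∀ n {p} → p ∈ Perm n → All (_< suc n) p
Perm-bounded n = IsPerm-bounded ∘ Perm-isPerm n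

map-Unique : {A B : Set} {f : A → B} {xs : List A} → Unique xs →
  (∀ {x y} → x ∈ xs → y ∈ xs → f x ≡ f y → x ≡ y) → Unique (map f xs)
map-Unique {xs = []}     []       inj = []
map-Unique {xs = x ∷ xs} (x∉ ∷ u) inj =
  AllP.map⁺ (All.tabulate (λ {y} y∈ e → All.lookup x∉ y∈ (inj (here refl) (there y∈) e)))
  ∷ map-Unique u (λ x∈ y∈ → inj (there x∈) (there y∈))

Perm-unique : ∀ n → Unique (Perm n)
Perm-unique zero    = [] ∷ []
Perm-unique (suc n) =
  map-Unique (UniqueP.cartesianProduct⁺ (Perm-unique n) (UniqueP.upTo⁺ (suc n))) injective
  where
  valid : ∀ {w s} → (w , s) ∈ cartesianProduct (Perm n) (upTo (suc n)) →
    All (_< suc n) w × s ≤ length w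
  valid m with ∈-cartesianProduct⁻ (Perm n) (upTo (suc n)) m
  ... | w∈ , s∈ = Perm-bounded n w∈ , subst (_ ≤_) (sym (Perm-length n w∈)) (s≤s⁻¹ (∈-upTo⁻ s∈))
  injective : ∀ {x y} → x ∈ cartesianProduct (Perm n) (upTo (suc n)) →
    y ∈ cartesianProduct (Perm n) (upTo (suc n)) → insertAt (suc n) x ≡ insertAt (suc n) y → x ≡ y
  injective {w , s} {w' , s'} m m' e with valid m | valid m'
  ... | bw , le | bw' , le' with ins-injective s s' (suc n) w w' bw bw' le le' e
  ...   | refl , refl = refl

-- Order-invariant statistics.

-- rank x w is the number of entries of w below x; std w replaces each entry by its rank, i.e.
-- keeps only the relative order of the entries.
rank : ℕ → List ℕ → ℕ
rank x w = ∑ w (λ y → 𝟙 (y <ᵇ x))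

std : List ℕ → List ℕ
std w = map (λ x → rank x w) w

rank-above-all : ∀ M w → All (_< M) w → rank M w ≡ length w
rank-above-all M []      []         = refl
rank-above-all M (y ∷ w) (y<M ∷ bw) rewrite <ᵇ-true y<M = cong suc (rank-above-all M w bw)

rank-ins : ∀ x s M w → ¬ M < x → rank x (ins s M w) ≡ rank x w
rank-ins x s M w M≮x =
  trans (∑-ins (λ y → 𝟙 (y <ᵇ x)) s M w) (cong (λ b → 𝟙 b + rank x w) (<ᵇ-false M≮x))

std-ins : ∀ s M w → All (_< M) w → std (ins s M w) ≡ ins s (length w) (std w)
std-ins s M w bw = begin
    map (λ x → rank x (ins s M w)) (ins s M w)
  ≡⟨ map-ins (λ x → rank x (ins s M w)) s M w ⟩
    ins s (rank M (ins s M w)) (map (λ x → rank x (ins s M w)) w)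
  ≡⟨ cong₂ (ins s) (trans (rank-ins M s M w (<-irrefl refl)) (rank-above-all M w bw))
       (map-on-All (All.map (λ x<M → rank-ins _ s M w (<-asym x<M)) bw)) ⟩
    ins s (length w) (std w)
  ∎
  where
  open ≡-Reasoning
  map-on-All : ∀ {f g : ℕ → ℕ} {v} → All (λ x → f x ≡ g x) v → map f v ≡ map g v
  map-on-All []       = refl
  map-on-All (e ∷ es) = cong₂ _∷_ e (map-on-All es)

length-std : ∀ w → length (std w) ≡ length w
length-std w = length-map (λ x → rank x w) w

𝟙-<ᵇ-mono : ∀ y {b a} → b ≤ a → 𝟙 (y <ᵇ b) ≤ 𝟙 (y <ᵇ a)
𝟙-<ᵇ-mono y {b} b≤a with y <? b
... | yes y<b rewrite <ᵇ-true y<b | <ᵇ-true (<-≤-trans y<b b≤a) = ≤-refl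
... | no  y≮b rewrite <ᵇ-false y≮b = z≤n

rank-mono : ∀ w {b a} → b ≤ a → rank b w ≤ rank a w
rank-mono w b≤a = ∑-mono w (λ y → 𝟙-<ᵇ-mono y b≤a)

rank-strict : ∀ {w a b} → a < b → a ∈ w → rank a w < rank b w
rank-strict {a ∷ w} {a} {b} a<b (here refl)
  rewrite <ᵇ-false {a} {a} (<-irrefl refl) | <ᵇ-true a<b = s≤s (rank-mono w (<⇒≤ a<b))
rank-strict {z ∷ w} {a} {b} a<b (there a∈w) =
  subst (_≤ 𝟙 (z <ᵇ b) + rank b w) (+-suc (𝟙 (z <ᵇ a)) (rank a w))
    (+-mono-≤ (𝟙-<ᵇ-mono z (<⇒≤ a<b)) (rank-strict a<b a∈w))

rank-<ᵇ : ∀ w a b → a ∈ w → (rank a w <ᵇ rank b w) ≡ (a <ᵇ b)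
rank-<ᵇ w a b a∈w with a <? b
... | yes a<b = trans (<ᵇ-true (rank-strict a<b a∈w)) (sym (<ᵇ-true a<b))
... | no  a≮b = trans (<ᵇ-false (λ lt → <⇒≱ lt (rank-mono w (≮⇒≥ a≮b)))) (sym (<ᵇ-false a≮b))

OrderInvariant : (List ℕ → ℕ) → Set
OrderInvariant A = ∀ u v → std u ≡ std v → A u ≡ A v

fresh : List ℕ → ℕ
fresh []       = 0
fresh (x ∷ xs) = suc x ⊔ fresh xs

all<fresh : ∀ u → All (_< fresh u) u
all<fresh []       = []
all<fresh (x ∷ xs) =
  m≤m⊔n (suc x) (fresh xs) ∷ All.map (λ lt → ≤-trans lt (m≤n⊔m (suc x) (fresh xs))) (all<fresh xs)

-- For an order-invariant A, the value of A after inserting a new maximum only depends on the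
-- position; `insertions A u` sums it over all positions.
ins-fresh : ∀ A → OrderInvariant A → ∀ s {M u} → All (_< M) u → A (ins s M u) ≡ A (ins s (fresh u) u)
ins-fresh A inv s {M} {u} bu = inv _ _ (trans (std-ins s M u bu) (sym (std-ins s (fresh u) u (all<fresh u))))

insertions : (List ℕ → ℕ) → List ℕ → ℕ
insertions A u = ∑ (upTo (suc (length u))) (λ s → A (ins s (fresh u) u))

∑-ins-max : ∀ A → OrderInvariant A → ∀ {u M} m → length u ≡ m → All (_< M) u →
  ∑ (upTo (suc m)) (λ s → A (ins s M u)) ≡ insertions A u
∑-ins-max A inv {u} _ refl bu = ∑-cong (upTo (suc (length u))) (λ {s} _ → ins-fresh A inv s bu)

OrderInvariant-insertions : ∀ A → OrderInvariant A → OrderInvariant (insertions A)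
OrderInvariant-insertions A inv u v e = begin
    insertions A u
  ≡⟨ cong (λ L → ∑ (upTo (suc L)) (λ s → A (ins s (fresh u) u))) same-length ⟩
    ∑ (upTo (suc (length v))) (λ s → A (ins s (fresh u) u))
  ≡⟨ ∑-cong (upTo (suc (length v))) (λ {s} _ → inv _ _ (trans (std-ins s _ u (all<fresh u))
       (trans (cong₂ (ins s) same-length e) (sym (std-ins s _ v (all<fresh v)))))) ⟩
    insertions A v
  ∎
  where
  open ≡-Reasoning
  same-length : length u ≡ length v
  same-length = trans (sym (length-std u)) (trans (cong length e) (length-std v))

∑-Perm-insertions : ∀ A → OrderInvariant A → ∀ n → ∑ (Perm (suc n)) A ≡ ∑ (Perm n) (insertions A)
∑-Perm-insertions A inv n = trans (∑-Perm-suc n A)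
  (∑-cong (Perm n) (λ w∈ → ∑-ins-max A inv n (Perm-length n w∈) (Perm-bounded n w∈)))

-- The shuffle lemma.

-- At positions s ≤ a it lands in the prefix of
-- length a+1, which is then an insertion into the first a entries of w; at later positions it
-- lands in the suffix after the first a+1 entries.
∑-insert-split : ∀ a b A B → OrderInvariant A → OrderInvariant B → ∀ {w X} →
  length w ≡ a + suc b → All (_< X) w →
  ∑ (upTo (suc a + suc b)) (λ s → A (take (suc a) (ins s X w)) * B (drop (suc a) (ins s X w)))
  ≡ insertions A (take a w) * B (drop a w) + A (take (suc a) w) * insertions B (drop (suc a) w)
∑-insert-split a b A B invA invB {w} {X} len bw =
  trans (∑-upTo-+ (suc a) (suc b) G) (cong₂ _+_ early late)
  where
  open ≡-Reasoning
  G : ℕ → ℕ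
  G s = A (take (suc a) (ins s X w)) * B (drop (suc a) (ins s X w))
  suc-a≤ : suc a ≤ length w
  suc-a≤ = subst (suc a ≤_) (trans (sym (+-suc a b)) (sym len)) (s≤s (m≤m+n a b))
  early : ∑ (upTo (suc a)) G ≡ insertions A (take a w) * B (drop a w)
  early = begin
      ∑ (upTo (suc a)) G
    ≡⟨ ∑-cong (upTo (suc a)) (λ s∈ → let s≤a = s≤s⁻¹ (∈-upTo⁻ s∈) in
         cong₂ (λ u v → A u * B v) (take-ins-≤ a _ X w s≤a) (drop-ins-≤ a _ X w s≤a)) ⟩
      ∑ (upTo (suc a)) (λ s → A (ins s X (take a w)) * B (drop a w))
    ≡⟨ ∑-*ʳ (upTo (suc a)) (B (drop a w)) (λ s → A (ins s X (take a w))) ⟩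
      ∑ (upTo (suc a)) (λ s → A (ins s X (take a w))) * B (drop a w)
    ≡⟨ cong (_* B (drop a w)) (∑-ins-max A invA a
         (trans (length-take a w) (m≤n⇒m⊓n≡m (≤-trans (n≤1+n a) suc-a≤))) (AllP.take⁺ a bw)) ⟩
      insertions A (take a w) * B (drop a w)
    ∎
  late : ∑ (upTo (suc b)) (λ r → G (suc a + r)) ≡ A (take (suc a) w) * insertions B (drop (suc a) w)
  late = begin
      ∑ (upTo (suc b)) (λ r → G (suc a + r))
    ≡⟨ ∑-cong (upTo (suc b)) (λ {r} _ →
         cong₂ (λ u v → A u * B v) (take-ins-≥ (suc a) r X w suc-a≤) (drop-ins-≥ (suc a) r X w suc-a≤)) ⟩
      ∑ (upTo (suc b)) (λ r → A (take (suc a) w) * B (ins r X (drop (suc a) w)))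
    ≡⟨ ∑-*ˡ (upTo (suc b)) (A (take (suc a) w)) (λ r → B (ins r X (drop (suc a) w))) ⟩
      A (take (suc a) w) * ∑ (upTo (suc b)) (λ r → B (ins r X (drop (suc a) w)))
    ≡⟨ cong (A (take (suc a) w) *_) (∑-ins-max B invB b
         (trans (length-drop (suc a) w) (trans (cong (_∸ suc a) (trans len (+-suc a b))) (m+n∸m≡n (suc a) b)))
         (AllP.drop⁺ (suc a) bw)) ⟩
      A (take (suc a) w) * insertions B (drop (suc a) w)
    ∎

-- Shuffle lemma: as q runs over the permutations of {1,…,a+b}, the pair (prefix of length a,
-- rest) standardises to each pair of permutations of sizes a and b exactly C(a+b,a) times.
shuffle : ∀ a b (A B : List ℕ → ℕ) → OrderInvariant A → OrderInvariant B →
  ∑ (Perm (a + b)) (λ q → A (take a q) * B (drop a q)) ≡ ((a + b) C a) * ∑ (Perm a) A * ∑ (Perm b) B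
shuffle zero b A B invA invB =
  trans (∑-*ˡ (Perm b) (A []) B) (cong (_* ∑ (Perm b) B) (sym (trans (*-identityˡ (A [] + 0)) (+-identityʳ (A [])))))
shuffle (suc a) zero A B invA invB rewrite +-identityʳ a = begin
    ∑ (Perm (suc a)) (λ q → A (take (suc a) q) * B (drop (suc a) q))
  ≡⟨ ∑-cong (Perm (suc a)) (λ {q} q∈ → let len = ≤-reflexive (Perm-length (suc a) q∈) in
       cong₂ (λ u v → A u * B v) (take-all (suc a) q len) (drop-all (suc a) q len)) ⟩
    ∑ (Perm (suc a)) (λ q → A q * B [])
  ≡⟨ ∑-*ʳ (Perm (suc a)) (B []) A ⟩
    ∑ (Perm (suc a)) A * B []
  ≡⟨ cong₂ _*_ (sym (trans (cong (_* ∑ (Perm (suc a)) A) (nCn≡1 (suc a))) (*-identityˡ _)))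
               (sym (+-identityʳ (B []))) ⟩
    (suc a C suc a) * ∑ (Perm (suc a)) A * (B [] + 0)
  ∎
  where open ≡-Reasoning
-- Induction on a + b: by the previous lemma the maximum of a permutation of size a+b+2 lies either
-- in the prefix (sizes a, b+1 with `insertions A`) or in the suffix (sizes a+1, b with
-- `insertions B`); Pascal's rule adds the two binomial coefficients.
shuffle (suc a) (suc b) A B invA invB = begin
    ∑ (Perm (suc N)) (λ q → A (take (suc a) q) * B (drop (suc a) q))
  ≡⟨ ∑-Perm-suc N _ ⟩
    ∑ (Perm N) (λ w → ∑ (upTo (suc N)) (λ s →
      A (take (suc a) (ins s (suc N) w)) * B (drop (suc a) (ins s (suc N) w))))
  ≡⟨ ∑-cong (Perm N) (λ w∈ → ∑-insert-split a b A B invA invB (Perm-length N w∈) (Perm-bounded N w∈)) ⟩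
    ∑ (Perm N) (λ w → insertions A (take a w) * B (drop a w) + A (take (suc a) w) * insertions B (drop (suc a) w))
  ≡⟨ ∑-+ (Perm N) _ _ ⟩
    ∑ (Perm N) (λ w → insertions A (take a w) * B (drop a w))
      + ∑ (Perm N) (λ w → A (take (suc a) w) * insertions B (drop (suc a) w))
  ≡⟨ cong₂ _+_ max-in-prefix max-in-suffix ⟩
    (N C a) * ∑ (Perm a) (insertions A) * PB + (N C suc a) * PA * ∑ (Perm b) (insertions B)
  ≡⟨ cong₂ (λ x y → (N C a) * x * PB + (N C suc a) * PA * y)
       (sym (∑-Perm-insertions A invA a)) (sym (∑-Perm-insertions B invB b)) ⟩
    (N C a) * PA * PB + (N C suc a) * PA * PB
  ≡⟨ trans (sym (*-distribʳ-+ PB ((N C a) * PA) ((N C suc a) * PA)))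
           (cong (_* PB) (sym (*-distribʳ-+ PA (N C a) (N C suc a)))) ⟩
    ((N C a) + (N C suc a)) * PA * PB
  ≡⟨ cong (λ c → c * PA * PB) (nCk+nC[k+1]≡[n+1]C[k+1] N a) ⟩
    (suc N C suc a) * PA * PB
  ∎
  where
  open ≡-Reasoning
  N = a + suc b
  PA = ∑ (Perm (suc a)) A
  PB = ∑ (Perm (suc b)) B
  max-in-prefix : ∑ (Perm N) (λ w → insertions A (take a w) * B (drop a w))
                  ≡ (N C a) * ∑ (Perm a) (insertions A) * PB
  max-in-prefix = shuffle a (suc b) (insertions A) B (OrderInvariant-insertions A invA) invB
  max-in-suffix : ∑ (Perm N) (λ w → A (take (suc a) w) * insertions B (drop (suc a) w))
                 ≡ (N C suc a) * PA * ∑ (Perm b) (insertions B)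
  max-in-suffix = subst (λ M → ∑ (Perm M) (λ w → A (take (suc a) w) * insertions B (drop (suc a) w))
                              ≡ (M C suc a) * PA * ∑ (Perm b) (insertions B))
                   (sym (+-suc a b))
                   (shuffle (suc a) b A (insertions B) invA (OrderInvariant-insertions B invB))

-- Runs under insertion of a maximum.

incLast : List ℕ → List ℕ
incLast []           = []
incLast (x ∷ [])     = suc x ∷ []
incLast (x ∷ y ∷ xs) = x ∷ incLast (y ∷ xs)

incLast-snoc : ∀ I a → incLast (I ++ [ a ]) ≡ I ++ [ suc a ]
incLast-snoc []          a = refl
incLast-snoc (x ∷ [])    a = refl
incLast-snoc (x ∷ y ∷ I) a = cong (x ∷_) (incLast-snoc (y ∷ I) a)

last-snoc : ∀ (I : List ℕ) a → last (I ++ [ a ]) ≡ just a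
last-snoc []          a = refl
last-snoc (x ∷ [])    a = refl
last-snoc (x ∷ y ∷ I) a = last-snoc (y ∷ I) a

runsFrom-view : ∀ p l ys → ∃₂ λ I r → runsFrom p (suc l) ys ≡ I ++ [ suc r ]
runsFrom-view p l []       = [] , l , refl
runsFrom-view p l (y ∷ ys) with p <ᵇ y
... | true  = runsFrom-view y (suc l) ys
... | false with runsFrom-view y 0 ys
...   | I , r , e = suc l ∷ I , r , cong (suc l ∷_) e

incLast-runsFrom : ∀ l p m ys → incLast (l ∷ runsFrom p (suc m) ys) ≡ l ∷ incLast (runsFrom p (suc m) ys)
incLast-runsFrom l p m ys with runsFrom-view p m ys
... | I , r , e rewrite e = trans (incLast-snoc (l ∷ I) (suc r)) (cong (l ∷_) (sym (incLast-snoc I (suc r))))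

runsFrom-++-max : ∀ p l ys X v → All (_< X) (p ∷ ys) → All (_< X) v →
  runsFrom p l (ys ++ X ∷ v) ≡ incLast (runsFrom p l ys) ++ runLengths v
runsFrom-++-max p l [] X v (p<X ∷ []) bv rewrite <ᵇ-true p<X = new-run v bv
  where
  new-run : ∀ v → All (_< X) v → runsFrom X (suc l) v ≡ suc l ∷ runLengths v
  new-run []      _          = refl
  new-run (y ∷ v) (y<X ∷ _) rewrite <ᵇ-false (<-asym y<X) = refl
runsFrom-++-max p l (y ∷ ys) X v (_ ∷ by) bv with p <ᵇ y
... | true  = runsFrom-++-max y (suc l) ys X v by bv
... | false = trans (cong (l ∷_) (runsFrom-++-max y 1 ys X v by bv))
                    (cong (_++ runLengths v) (sym (incLast-runsFrom l y 0 ys)))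

admissible-last : ∀ k j p r → lastRun p ≡ just r →
  admissible k j p ≡ (all (_≤ᵇ k) (runLengths p) ∧ (r ≤ᵇ j))
admissible-last k j p r e with lastRun p
admissible-last k j p r refl | .(just r) = refl

admissible-view : ∀ k j p I r → runLengths p ≡ I ++ [ r ] →
  admissible k j p ≡ (all (_≤ᵇ k) I ∧ (r ≤ᵇ k ⊓ j))
admissible-view k j p I r e = begin
    admissible k j p
  ≡⟨ admissible-last k j p r (trans (cong last e) (last-snoc I r)) ⟩
    all (_≤ᵇ k) (runLengths p) ∧ (r ≤ᵇ j)
  ≡⟨ cong (λ R → all (_≤ᵇ k) R ∧ (r ≤ᵇ j)) e ⟩
    all (_≤ᵇ k) (I ++ [ r ]) ∧ (r ≤ᵇ j)
  ≡⟨ cong (_∧ (r ≤ᵇ j)) (all-++ (_≤ᵇ k) I [ r ]) ⟩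
    (all (_≤ᵇ k) I ∧ ((r ≤ᵇ k) ∧ true)) ∧ (r ≤ᵇ j)
  ≡⟨ cong (λ b → (all (_≤ᵇ k) I ∧ b) ∧ (r ≤ᵇ j)) (∧-identityʳ (r ≤ᵇ k)) ⟩
    (all (_≤ᵇ k) I ∧ (r ≤ᵇ k)) ∧ (r ≤ᵇ j)
  ≡⟨ ∧-assoc (all (_≤ᵇ k) I) (r ≤ᵇ k) (r ≤ᵇ j) ⟩
    all (_≤ᵇ k) I ∧ ((r ≤ᵇ k) ∧ (r ≤ᵇ j))
  ≡⟨ cong (all (_≤ᵇ k) I ∧_) (≤ᵇ-⊓ r k j) ⟩
    all (_≤ᵇ k) I ∧ (r ≤ᵇ k ⊓ j)
  ∎
  where open ≡-Reasoning

-- The final run is nonempty, so nothing is admissible for j = 0.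
admissible-zero : ∀ k p → admissible k 0 p ≡ false
admissible-zero k []       = refl
admissible-zero k (x ∷ xs) with runsFrom-view x 0 xs
... | I , r , e = trans (admissible-view k 0 (x ∷ xs) I (suc r) e)
  (trans (cong (λ m → all (_≤ᵇ k) I ∧ (suc r ≤ᵇ m)) (⊓-zeroʳ k)) (∧-zeroʳ (all (_≤ᵇ k) I)))

-- A new maximum in front of a nonempty list forms a run of length 1 of its own.
admissible-front : ∀ k' j X y w → y < X → admissible (suc k') j (X ∷ y ∷ w) ≡ admissible (suc k') j (y ∷ w)
admissible-front k' j X y w y<X with runsFrom-view y 0 w
... | J , c , e = trans (admissible-view (suc k') j (X ∷ y ∷ w) (1 ∷ J) (suc c) runs)
                        (sym (admissible-view (suc k') j (y ∷ w) J (suc c) e))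
  where
  runs : runLengths (X ∷ y ∷ w) ≡ (1 ∷ J) ++ [ suc c ]
  runs rewrite <ᵇ-false (<-asym y<X) = cong (1 ∷_) e

-- A new maximum between nonempty lists u and v: the final run of u grows by one (so it must
-- have been at most k-1) and v contributes its own runs.
admissible-middle : ∀ k' j u X v → All (_< X) u → All (_< X) v → u ≢ [] → v ≢ [] →
  𝟙 (admissible (suc k') j (u ++ X ∷ v)) ≡ 𝟙 (admissible (suc k') k' u) * 𝟙 (admissible (suc k') j v)
admissible-middle k' j []      X v       _  _  u≢[] _    = ⊥-elim (u≢[] refl)
admissible-middle k' j (x ∷ u) X []      _  _  _    v≢[] = ⊥-elim (v≢[] refl)
admissible-middle k' j (x ∷ u) X (y ∷ v) bu bv _    _    with runsFrom-view x 0 u | runsFrom-view y 0 v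
... | I , r , eu | J , c , ev = begin
    𝟙 (admissible k j (x ∷ u ++ X ∷ y ∷ v))
  ≡⟨ cong 𝟙 (admissible-view k j (x ∷ u ++ X ∷ y ∷ v) (I ++ suc (suc r) ∷ J) (suc c) runs) ⟩
    𝟙 (all ok (I ++ suc (suc r) ∷ J) ∧ last-ok)
  ≡⟨ cong (λ b → 𝟙 (b ∧ last-ok)) (all-++ ok I (suc (suc r) ∷ J)) ⟩
    𝟙 ((all ok I ∧ (ok (suc (suc r)) ∧ all ok J)) ∧ last-ok)
  ≡⟨ cong 𝟙 (regroup (all ok I) (ok (suc (suc r))) (all ok J) last-ok) ⟩
    𝟙 ((all ok I ∧ ok (suc (suc r))) ∧ (all ok J ∧ last-ok))
  ≡⟨ 𝟙-∧ (all ok I ∧ ok (suc (suc r))) (all ok J ∧ last-ok) ⟩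
    𝟙 (all ok I ∧ ok (suc (suc r))) * 𝟙 (all ok J ∧ last-ok)
  ≡⟨ cong₂ (λ b c → 𝟙 (all ok I ∧ b) * 𝟙 c) grown (sym (admissible-view k j (y ∷ v) J (suc c) ev)) ⟩
    𝟙 (all ok I ∧ (suc r ≤ᵇ k ⊓ k')) * 𝟙 (admissible k j (y ∷ v))
  ≡⟨ cong (λ b → 𝟙 b * 𝟙 (admissible k j (y ∷ v))) (sym (admissible-view k k' (x ∷ u) I (suc r) eu)) ⟩
    𝟙 (admissible k k' (x ∷ u)) * 𝟙 (admissible k j (y ∷ v))
  ∎
  where
  open ≡-Reasoning
  k = suc k'
  ok : ℕ → Bool
  ok = _≤ᵇ k
  last-ok = suc c ≤ᵇ k ⊓ j
  runs : runLengths (x ∷ u ++ X ∷ y ∷ v) ≡ (I ++ suc (suc r) ∷ J) ++ [ suc c ]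
  runs = begin
      runsFrom x 1 (u ++ X ∷ y ∷ v)
      ≡⟨ runsFrom-++-max x 1 u X (y ∷ v) bu bv ⟩
      incLast (runsFrom x 1 u) ++ runLengths (y ∷ v)
      ≡⟨ cong₂ _++_ (trans (cong incLast eu) (incLast-snoc I (suc r))) ev ⟩
      (I ++ [ suc (suc r) ]) ++ J ++ [ suc c ]
      ≡⟨ ++-assoc I [ suc (suc r) ] (J ++ [ suc c ]) ⟩
      I ++ suc (suc r) ∷ J ++ [ suc c ]
      ≡⟨ sym (++-assoc I (suc (suc r) ∷ J) [ suc c ]) ⟩
      (I ++ suc (suc r) ∷ J) ++ [ suc c ]
      ∎
  regroup : ∀ a b d e → ((a ∧ (b ∧ d)) ∧ e) ≡ ((a ∧ b) ∧ (d ∧ e))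
  regroup false b     d e = refl
  regroup true  false d e = refl
  regroup true  true  d e = refl
  grown : ok (suc (suc r)) ≡ (suc r ≤ᵇ k ⊓ k')
  grown = trans (≤ᵇ-suc (suc r) k') (cong (suc r ≤ᵇ_) (sym (m≥n⇒m⊓n≡n (n≤1+n k'))))

-- A new maximum at the end of a nonempty list lengthens its final run by one.
admissible-end : ∀ k' j' x u X → All (_< X) (x ∷ u) → j' ≤ k' →
  admissible (suc k') (suc j') ((x ∷ u) ++ [ X ]) ≡ admissible (suc k') j' (x ∷ u)
admissible-end k' j' x u X bu j'≤k' with runsFrom-view x 0 u
... | I , r , e = begin
    admissible (suc k') (suc j') ((x ∷ u) ++ [ X ])
  ≡⟨ admissible-view (suc k') (suc j') ((x ∷ u) ++ [ X ]) I (suc (suc r)) runs ⟩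
    all (_≤ᵇ suc k') I ∧ (suc (suc r) ≤ᵇ suc (k' ⊓ j'))
  ≡⟨ cong (all (_≤ᵇ suc k') I ∧_) (≤ᵇ-suc (suc r) (k' ⊓ j')) ⟩
    all (_≤ᵇ suc k') I ∧ (suc r ≤ᵇ k' ⊓ j')
  ≡⟨ cong (λ m → all (_≤ᵇ suc k') I ∧ (suc r ≤ᵇ m))
       (trans (m≥n⇒m⊓n≡n j'≤k') (sym (m≥n⇒m⊓n≡n (m≤n⇒m≤1+n j'≤k')))) ⟩
    all (_≤ᵇ suc k') I ∧ (suc r ≤ᵇ suc k' ⊓ j')
  ≡⟨ sym (admissible-view (suc k') j' (x ∷ u) I (suc r) e) ⟩
    admissible (suc k') j' (x ∷ u)
  ∎
  where
  open ≡-Reasoning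
  runs : runLengths ((x ∷ u) ++ [ X ]) ≡ I ++ [ suc (suc r) ]
  runs = trans (runsFrom-++-max x 1 u X [] bu [])
           (trans (++-identityʳ _) (trans (cong incLast e) (incLast-snoc I (suc r))))

-- runsFrom only looks at comparisons between entries, which an order-preserving f keeps.
runsFrom-map : (f : ℕ → ℕ) → ∀ p l ys → (∀ a b → a ∈ p ∷ ys → (f a <ᵇ f b) ≡ (a <ᵇ b)) →
  runsFrom (f p) l (map f ys) ≡ runsFrom p l ys
runsFrom-map f p l []       f-mono = refl
runsFrom-map f p l (y ∷ ys) f-mono rewrite f-mono p y (here refl) with p <ᵇ y
... | true  = runsFrom-map f y (suc l) ys (λ a b a∈ → f-mono a b (there a∈))
... | false = cong (l ∷_) (runsFrom-map f y 1 ys (λ a b a∈ → f-mono a b (there a∈)))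

runLengths-std : ∀ p → runLengths (std p) ≡ runLengths p
runLengths-std []       = refl
runLengths-std (x ∷ xs) = runsFrom-map (λ y → rank y (x ∷ xs)) x 1 xs (rank-<ᵇ (x ∷ xs))

admissible-std : ∀ k j p → admissible k j (std p) ≡ admissible k j p
admissible-std k j []       = refl
admissible-std k j (x ∷ xs) with runsFrom-view x 0 xs
... | I , r , e = trans (admissible-view k j (std (x ∷ xs)) I (suc r) (trans (runLengths-std (x ∷ xs)) e))
                        (sym (admissible-view k j (x ∷ xs) I (suc r) e))

OrderInvariant-admissible : ∀ k j → OrderInvariant (𝟙 ∘ admissible k j)
OrderInvariant-admissible k j u v e =
  cong 𝟙 (trans (sym (admissible-std k j u)) (trans (cong (admissible k j) e) (admissible-std k j v)))

-- The enumeration `perms` defining U lists the same permutations as `Perm`.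

concatMap-map : {A B C : Set} (f : A → B → C) (xs : List A) (ys : List B) →
  concatMap (λ x → map (f x) ys) xs ≡ cartesianProductWith f xs ys
concatMap-map f []       ys = refl
concatMap-map f (x ∷ xs) ys = cong (map (f x) ys ++_) (concatMap-map f xs ys)

prepend : List ℕ → ℕ → List ℕ
prepend w i = suc i ∷ w

words-suc : ∀ m n → words (suc m) n ≡ cartesianProductWith prepend (words m n) (upTo n)
words-suc m n = concatMap-map prepend (words m n) (upTo n)

words-unique : ∀ m n → Unique (words m n)
words-unique zero    n = [] ∷ []
words-unique (suc m) n rewrite words-suc m n =
  UniqueP.cartesianProductWith⁺ prepend injective (words-unique m n) (UniqueP.upTo⁺ n)
  where
  injective : ∀ {w x y z} → prepend w y ≡ prepend x z → w ≡ x × y ≡ z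
  injective e with ∷-injective e
  ... | e₁ , e₂ = e₂ , suc-injective e₁

words-∈⁻ : ∀ m n {p} → p ∈ words m n → length p ≡ m × All (InRange n) p
words-∈⁻ zero    n (here refl) = refl , []
words-∈⁻ (suc m) n {p} p∈ rewrite words-suc m n with ∈-cartesianProductWith⁻ prepend (words m n) (upTo n) p∈
... | w , i , w∈ , i∈ , refl with words-∈⁻ m n w∈
...   | len , inRange = cong suc len , (z<s , ∈-upTo⁻ i∈) ∷ inRange

words-∈⁺ : ∀ m n p → length p ≡ m → All (InRange n) p → p ∈ words m n
words-∈⁺ zero    n []          refl []                  = here refl
words-∈⁺ (suc m) n (suc i ∷ p) len  ((_ , i<n) ∷ inRange) rewrite words-suc m n =
  ∈-cartesianProductWith⁺ prepend (words-∈⁺ m n p (suc-injective len) inRange) (∈-upTo⁺ i<n)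

any-≡ᵇ-false : ∀ x xs → All (x ≢_) xs → any (λ y → x ≡ᵇ y) xs ≡ false
any-≡ᵇ-false x []       []          = refl
any-≡ᵇ-false x (y ∷ xs) (x≢y ∷ x∉) rewrite ≡ᵇ-false x≢y = any-≡ᵇ-false x xs x∉

any-≡ᵇ-false⁻ : ∀ x xs → any (λ y → x ≡ᵇ y) xs ≡ false → All (x ≢_) xs
any-≡ᵇ-false⁻ x []       e = []
any-≡ᵇ-false⁻ x (y ∷ xs) e with x ≡ᵇ y in eq
... | false = (λ x≡y → subst T eq (≡⇒≡ᵇ x y x≡y)) ∷ any-≡ᵇ-false⁻ x xs e

Unique⇒distinct : ∀ p → Unique p → T (distinct p)
Unique⇒distinct []       []       = tt
Unique⇒distinct (x ∷ xs) (x∉ ∷ u) rewrite any-≡ᵇ-false x xs x∉ = Unique⇒distinct xs u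

distinct⇒Unique : ∀ p → T (distinct p) → Unique p
distinct⇒Unique []       t = []
distinct⇒Unique (x ∷ xs) t with any (λ y → x ≡ᵇ y) xs in eq
... | false = any-≡ᵇ-false⁻ x xs eq ∷ distinct⇒Unique xs t

perms-unique : ∀ n → Unique (perms n)
perms-unique n = UniqueP.filter⁺ (T? ∘ distinct) (words-unique n n)

∈perms⇒IsPerm : ∀ n {p} → p ∈ perms n → IsPerm n p
∈perms⇒IsPerm n {p} p∈ with ∈-filter⁻ (T? ∘ distinct) {xs = words n n} p∈
... | p∈words , t with words-∈⁻ n n p∈words
...   | len , inRange = len , inRange , distinct⇒Unique p t

IsPerm⇒∈perms : ∀ n {p} → IsPerm n p → p ∈ perms n
IsPerm⇒∈perms n {p} (len , inRange , u) =
  ∈-filter⁺ (T? ∘ distinct) (words-∈⁺ n n p len inRange) (Unique⇒distinct p u)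

Unique-delete : ∀ (p₁ : List ℕ) {X p₂} → Unique (p₁ ++ X ∷ p₂) →
  All (X ≢_) (p₁ ++ p₂) × Unique (p₁ ++ p₂)
Unique-delete []       (X∉ ∷ u) = X∉ , u
Unique-delete (y ∷ p₁) (y∉ ∷ u) with Unique-delete p₁ u | AllP.++⁻ p₁ y∉
... | X∉ , u′ | y∉₁ , (y≢X ∷ y∉₂) = (y≢X ∘ sym) ∷ X∉ , AllP.++⁺ y∉₁ y∉₂ ∷ u′

lower-all : ∀ {n p} → All (InRange (suc n)) p → All (suc n ≢_) p → All (InRange n) p
lower-all inRange n+1∉ = All.zipWith lower (inRange , n+1∉)
  where
  lower : ∀ {n x} → InRange (suc n) x × suc n ≢ x → InRange n x
  lower ((1≤x , x≤n+1) , x≢n+1) = 1≤x , s≤s⁻¹ (≤∧≢⇒< x≤n+1 (x≢n+1 ∘ sym))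

remove-max : ∀ n p → Unique p → All (InRange (suc n)) p → suc n ∈ p →
  ∃₂ λ w s → ins s (suc n) w ≡ p × s ≤ length w × Unique w × All (InRange n) w
remove-max n p u inRange n+1∈p with ∈-∃++ n+1∈p
... | p₁ , p₂ , refl with Unique-delete p₁ u | AllP.++⁻ p₁ inRange
...   | n+1∉ , u′ | inRange₁ , (_ ∷ inRange₂) =
  p₁ ++ p₂ , length p₁ , ins-length p₁ (suc n) p₂ ,
  subst (length p₁ ≤_) (sym (length-++ p₁)) (m≤m+n (length p₁) (length p₂)) ,
  u′ , lower-all (AllP.++⁺ inRange₁ inRange₂) n+1∉

pigeonhole : ∀ n p → Unique p → All (InRange n) p → length p ≤ n
pigeonhole zero    []      _ _                  = z≤n
pigeonhole zero    (x ∷ p) _ ((1≤x , x≤0) ∷ _) = ⊥-elim (<-irrefl refl (≤-trans 1≤x x≤0))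
pigeonhole (suc n) p u inRange with suc n ∈? p
... | no  n+1∉p = m≤n⇒m≤1+n (pigeonhole n p u (lower-all inRange (¬Any⇒All¬ p n+1∉p)))
... | yes n+1∈p with remove-max n p u inRange n+1∈p
...   | w , s , refl , _ , u′ , inRange′ =
  subst (_≤ suc n) (sym (length-ins s (suc n) w)) (s≤s (pigeonhole n w u′ inRange′))

-- Completeness of Perm: remove the entry n from a permutation and insert it back.
IsPerm⇒∈Perm : ∀ n {p} → IsPerm n p → p ∈ Perm n
IsPerm⇒∈Perm zero    {[]} _ = here refl
IsPerm⇒∈Perm (suc n) {p} (len , inRange , u) with suc n ∈? p
... | no  n+1∉p = ⊥-elim (<-irrefl refl
      (subst (_≤ n) len (pigeonhole n p u (lower-all inRange (¬Any⇒All¬ p n+1∉p)))))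
... | yes n+1∈p with remove-max n p u inRange n+1∈p
...   | w , s , refl , s≤ , u′ , inRange′ =
  ∈-map⁺ (insertAt (suc n))
    (∈-cartesianProduct⁺ (IsPerm⇒∈Perm n (len′ , inRange′ , u′)) (∈-upTo⁺ (s≤s (subst (s ≤_) len′ s≤))))
  where
  len′ : length w ≡ n
  len′ = suc-injective (trans (sym (length-ins s (suc n) w)) len)

-- Both enumerations are duplicate-free with the same members, hence permutations of each other.
perms↭Perm : ∀ n → perms n ↭ Perm n
perms↭Perm n = ∼bag⇒↭ (unique∧set⇒bag (perms-unique n) (Perm-unique n)
  (mk⇔ (IsPerm⇒∈Perm n ∘ ∈perms⇒IsPerm n) (IsPerm⇒∈perms n ∘ Perm-isPerm n)))

Count : ℕ → ℕ → ℕ → ℕ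
Count k j n = ∑ (Perm n) (𝟙 ∘ admissible k j)

U≡Count : ∀ k j n → U k j n ≡ Count k j n
U≡Count k zero    n =
  sym (trans (∑-cong (Perm n) (λ {q} _ → cong 𝟙 (admissible-zero k q))) (∑-zero (Perm n)))
U≡Count k (suc j) n = trans (↭-length (filter-↭ (T? ∘ admissible k (suc j)) (perms↭Perm n)))
                            (length-filterᵇ (admissible k (suc j)) (Perm n))

insert-max-admissible : ∀ k' j' m {w X} → j' ≤ k' → length w ≡ suc m → All (_< X) w →
  ∑ (upTo (2 + m)) (λ s → 𝟙 (admissible (suc k') (suc j') (ins s X w)))
  ≡ 𝟙 (admissible (suc k') (suc j') w)
    + ∑ (upTo m) (λ i → 𝟙 (admissible (suc k') k' (take (suc i) w))
                        * 𝟙 (admissible (suc k') (suc j') (drop (suc i) w)))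
    + 𝟙 (admissible (suc k') j' w)
insert-max-admissible k' j' m {y ∷ w} {X} j'≤k' len bw@(y<X ∷ _) =
  trans (∑-upTo-ends m G) (cong₂ _+_ (cong₂ _+_ front (∑-cong (upTo m) (middle ∘ ∈-upTo⁻))) end)
  where
  k = suc k'
  j = suc j'
  G : ℕ → ℕ
  G s = 𝟙 (admissible k j (ins s X (y ∷ w)))
  front : G 0 ≡ 𝟙 (admissible k j (y ∷ w))
  front = cong 𝟙 (admissible-front k' j X y w y<X)
  middle : ∀ {i} → i < m →
    G (suc i) ≡ 𝟙 (admissible k k' (take (suc i) (y ∷ w))) * 𝟙 (admissible k j (drop (suc i) (y ∷ w)))
  middle {i} i<m =
    trans (cong (𝟙 ∘ admissible k j)
                (ins-take-drop (suc i) X (y ∷ w) (subst (suc i ≤_) (sym len) (s≤s (<⇒≤ i<m)))))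
          (admissible-middle k' j (take (suc i) (y ∷ w)) X (drop i w)
            (AllP.take⁺ (suc i) bw) (AllP.drop⁺ (suc i) bw) (λ ()) suffix-nonempty)
    where
    open ≡-Reasoning
    suffix-nonempty : drop i w ≢ []
    suffix-nonempty e = <⇒≢ (m<n⇒0<n∸m i<m) (sym (begin
      m ∸ i               ≡⟨ cong (_∸ i) (sym (suc-injective len)) ⟩
      length w ∸ i        ≡⟨ sym (length-drop i w) ⟩
      length (drop i w)   ≡⟨ cong length e ⟩
      0                   ∎))
  end : G (suc m) ≡ 𝟙 (admissible k j' (y ∷ w))
  end = cong 𝟙 (trans (cong (admissible k j) (ins-beyond (suc m) X (y ∷ w) (≤-reflexive len)))
                      (admissible-end k' j' y w X bw j'≤k'))

-- The recurrence for Count: sum the previous lemma over Perm (m+1) and evaluate the middle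
-- positions with the shuffle lemma (prefix of size i+1, suffix of size m-i).
Count-recurrence : ∀ k' j' m → j' ≤ k' →
  Count (suc k') (suc j') (2 + m)
  ≡ Count (suc k') (suc j') (suc m) + Count (suc k') j' (suc m)
    + ∑ (upTo m) (λ i → (suc m C suc i) * Count (suc k') k' (suc i) * Count (suc k') (suc j') (m ∸ i))
Count-recurrence k' j' m j'≤k' = begin
    Count k j (2 + m)
  ≡⟨ ∑-Perm-suc (suc m) (𝟙 ∘ admissible k j) ⟩
    ∑ (Perm (suc m)) (λ w → ∑ (upTo (2 + m)) (λ s → 𝟙 (admissible k j (ins s (2 + m) w))))
  ≡⟨ ∑-cong (Perm (suc m)) (λ w∈ →
       insert-max-admissible k' j' m j'≤k' (Perm-length (suc m) w∈) (Perm-bounded (suc m) w∈)) ⟩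
    ∑ (Perm (suc m)) (λ w → 𝟙 (admissible k j w) + ∑ (upTo m) (λ i → P i w) + 𝟙 (admissible k j' w))
  ≡⟨ ∑-+ (Perm (suc m)) _ (𝟙 ∘ admissible k j') ⟩
    ∑ (Perm (suc m)) (λ w → 𝟙 (admissible k j w) + ∑ (upTo m) (λ i → P i w)) + Count k j' (suc m)
  ≡⟨ cong (_+ Count k j' (suc m)) (∑-+ (Perm (suc m)) (𝟙 ∘ admissible k j) _) ⟩
    Count k j (suc m) + ∑ (Perm (suc m)) (λ w → ∑ (upTo m) (λ i → P i w)) + Count k j' (suc m)
  ≡⟨ cong (λ z → Count k j (suc m) + z + Count k j' (suc m))
       (trans (∑-swap (Perm (suc m)) (upTo m) (λ w i → P i w)) (∑-cong (upTo m) (shuffle-at ∘ ∈-upTo⁻))) ⟩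
    Count k j (suc m) + S + Count k j' (suc m)
  ≡⟨ xy∙z≈xz∙y (Count k j (suc m)) S (Count k j' (suc m)) ⟩
    Count k j (suc m) + Count k j' (suc m) + S
  ∎
  where
  open ≡-Reasoning
  k = suc k'
  j = suc j'
  P : ℕ → List ℕ → ℕ
  P i w = 𝟙 (admissible k k' (take (suc i) w)) * 𝟙 (admissible k j (drop (suc i) w))
  S = ∑ (upTo m) (λ i → (suc m C suc i) * Count k k' (suc i) * Count k j (m ∸ i))
  shuffle-at : ∀ {i} → i < m → ∑ (Perm (suc m)) (P i) ≡ (suc m C suc i) * Count k k' (suc i) * Count k j (m ∸ i)
  shuffle-at {i} i<m =
    subst (λ M → ∑ (Perm M) (P i) ≡ (M C suc i) * Count k k' (suc i) * Count k j (m ∸ i))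
      (cong suc (m+[n∸m]≡n (<⇒≤ i<m)))
      (shuffle (suc i) (m ∸ i) (𝟙 ∘ admissible k k') (𝟙 ∘ admissible k j)
        (OrderInvariant-admissible k k') (OrderInvariant-admissible k j))

-- The theorem, for n = m + 2, k = k' + 1 and j = j' + 1: translate U into Count and
-- reindex the sum by t = i + 2.
mainTheorem1 : (k : ℕ) → 1 ≤ k → (n j : ℕ) → 1 < n → 1 ≤ j → j ≤ k →
    U k j n ≡ U k j (n ∸ 1) + U k (j ∸ 1) (n ∸ 1)
      + sumFromTo 2 (n ∸ 1) (λ t → ((n ∸ 1) C (t ∸ 1)) * U k (k ∸ 1) (t ∸ 1) * U k j (n ∸ t))
mainTheorem1 (suc k') _ (suc (suc m)) (suc j') _ _ (s≤s j'≤k') = begin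
    U k j (2 + m)
  ≡⟨ U≡Count k j (2 + m) ⟩
    Count k j (2 + m)
  ≡⟨ Count-recurrence k' j' m j'≤k' ⟩
    Count k j (suc m) + Count k j' (suc m)
      + ∑ (upTo m) (λ i → (suc m C suc i) * Count k k' (suc i) * Count k j (m ∸ i))
  ≡⟨ sym (cong₂ _+_ (cong₂ _+_ (U≡Count k j (suc m)) (U≡Count k j' (suc m))) sum-as-∑) ⟩
    U k j (suc m) + U k j' (suc m)
      + sumFromTo 2 (suc m) (λ t → (suc m C (t ∸ 1)) * U k k' (t ∸ 1) * U k j (2 + m ∸ t))
  ∎
  where
  open ≡-Reasoning
  k = suc k'
  j = suc j'
  sum-as-∑ : sumFromTo 2 (suc m) (λ t → (suc m C (t ∸ 1)) * U k k' (t ∸ 1) * U k j (2 + m ∸ t))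
             ≡ ∑ (upTo m) (λ i → (suc m C suc i) * Count k k' (suc i) * Count k j (m ∸ i))
  sum-as-∑ = trans (sum-map _ (upTo m)) (∑-cong (upTo m) (λ {i} _ →
    cong₂ (λ x y → (suc m C suc i) * x * y) (U≡Count k k' (suc i)) (U≡Count k j (m ∸ i))))
mainTheorem1 (suc k') _ (suc zero) (suc j') (s≤s ()) _ _
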